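{- Let $p$ be a prime with $p-1=2^iq_1^{j_1}q_2^{j_2}$, where $q_1\neq q_2$ are odd primes and $i,j_1,j_2\ge 1$. Let $g$ be a generator of $\mathbb{Z}_p^*$. For any $g_1,g_2\in\mathcal{M}(g)$, $\mathcal{NI}(g_1)=\mathcal{NI}(g_2)$.
   Context: $\mathcal{G}$ is the set of generators of $\mathbb{Z}_p^*$, $\mathcal{R}$ the set of quadratic residues in $\mathbb{Z}_p^*$, $\mathcal{NG}$ the set of quadratic non-residues that are not generators. For $g\in\mathcal{G}$: $\mathcal{R}_g=\{r\in\mathcal{R}: gr\in\mathcal{G}\}$, $\bar{\mathcal{R}}_g=\{r\in\mathcal{R}: gr\in\mathcal{NG}\}$, $\mathcal{I}(g)=\mathcal{R}_g\cap\mathcal{R}_{g^{ -1}}$, $\mathcal{NI}(g)=\bar{\mathcal{R}}_g\cap\bar{\mathcal{R}}_{g^{ -1}}$, $\mathcal{M}(g)=\mathcal{G}\setminus\{gr,\ g^{ -1}r : r\in\mathcal{I}(g)\}$ (products mod $p$). -}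

module Defs where

open import Data.Nat using (ℕ; zero; suc; _+_; _*_; _∸_; _^_; _≤_; _<_; NonZero)
open import Data.Nat.DivMod using (_%_)
open import Data.Nat.Primality using (Prime)
open import Data.Product using (Σ; ∃; ∃-syntax; _×_)
open import Data.Sum using (_⊎_)
open import Relation.Nullary using (¬_)
open import Relation.Binary.PropositionalEquality using (_≡_; _≢_)

-- Elements of ℤ_p^* are represented by natural numbers x with 1 ≤ x < p;
-- multiplication is (x * y) % p.
module _ (p : ℕ) .{{_ : NonZero p}} where

  Unit : ℕ → Set
  Unit x = (1 ≤ x) × (x < p)

  Gen : ℕ → Set
  Gen g = Unit g × (∀ y → Unit y → ∃[ k ] ((g ^ k) % p ≡ y))

  QR : ℕ → Set
  QR r = Unit r × ∃[ x ] ((x * x) % p ≡ r)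

  NG : ℕ → Set
  NG x = Unit x × ¬ QR x × ¬ Gen x

  IsInv : ℕ → ℕ → Set
  IsInv g h = Unit h × ((g * h) % p ≡ 1)

  Rg : ℕ → ℕ → Set
  Rg g r = QR r × Gen ((g * r) % p)

  Rbar : ℕ → ℕ → Set
  Rbar g r = QR r × NG ((g * r) % p)

  I : ℕ → ℕ → Set
  I g r = Rg g r × (∀ h → IsInv g h → Rg h r)

  NI : ℕ → ℕ → Set
  NI g r = Rbar g r × (∀ h → IsInv g h → Rbar h r)

  M : ℕ → ℕ → Set
  M g x = Gen x × ¬ (∃[ r ] (I g r × (x ≡ (g * r) % p
                                       ⊎ (∀ h → IsInv g h → x ≡ (h * r) % p))))

-- Exponents of g are read modulo n = p − 1 = 2ⁱ q₁^j₁ q₂^j₂: g^e is a generator iff e is odd and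
-- prime to q₁ q₂, a square iff e is even, and in 𝒩𝒢 iff e is odd and divisible by q₁ or q₂.
-- If g^a ∈ ℳ(g) then q₁ or q₂ divides a − 2, for otherwise r = g^(a−1) ∈ ℐ(g) and g^a = g r;
-- likewise q₁ or q₂ divides a + 2 (take r = g^(a+1) and g^a = g⁻¹ r). An odd prime cannot divide
-- both, so a ≡ ±2 modulo q₁ and q₂ with opposite signs. For such a, a square g^s lies in 𝒩ℐ(g^a)
-- iff each of s + a and s − a is divisible by q₁ or q₂, which happens iff s ≡ 2 modulo both primes
-- or s ≡ −2 modulo both: a condition that no longer mentions a.

module Submission where

open import Defs
open import Data.Nat using (ℕ; zero; suc; _+_; _*_; _∸_; _^_; _≤_; _<_; NonZero; >-nonZero; z≤n; s≤s; s≤s⁻¹)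
open import Data.Nat.Properties
open import Data.Nat.DivMod using (_%_; _/_; %-distribˡ-*; %-remove-+ʳ; m%n<n; m<n⇒m%n≡m; m%n%n≡m%n; m≡m%n+[m/n]*n)
open import Data.Nat.Divisibility as ℕ using (∣1⇒≡1; m∣m*n; n∣m*n; n∣m*n*o)
open import Data.Nat.Coprimality using (Coprime; coprime-divisor; coprime-Bézout; prime⇒coprime)
open import Data.Nat.GCD using (module Bézout)
open import Data.Nat.Primality using (Prime; prime⇒nonTrivial; euclidsLemma; prime⇒irreducible; prime[2]; ¬prime[0]; ¬prime[1])
open import Data.Nat.Base using (nonTrivial⇒≢1)
open import Data.Integer using (ℤ; +_; -_; 0ℤ) renaming (_+_ to _+ℤ_; _-_ to _-ℤ_; _*_ to _*ℤ_)
import Data.Integer.Properties as ℤ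
open import Data.Integer.DivMod using (a≡a%ℕn+[a/ℕn]*n)
open import Data.Integer.Divisibility.Signed
  using (_∣_; divides; _∣?_; ∣-refl; ∣-trans; ∣m∣n⇒∣m+n; ∣m+n∣n⇒∣m; ∣m⇒∣m*n; ∣m⇒∣-m; ∣ᵤ⇒∣; ∣⇒∣ᵤ)
import Data.Integer.Coprimality as ℤ
open import Data.Integer.Tactic.RingSolver using (solve-∀)
open import Data.Fin using (Fin; toℕ; fromℕ<)
import Data.Fin.Properties as Fin
open import Data.Product using (_×_; _,_; ∃-syntax; proj₁; proj₂)
open import Data.Sum using (_⊎_; inj₁; inj₂; [_,_]′)
import Data.Sum as Sum
open import Data.Empty using (⊥; ⊥-elim)
open import Function.Base using (id; _∘_; _$_)
open import Function.Bundles using (_⇔_; mk⇔)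
open import Relation.Nullary using (¬_)
open import Relation.Nullary.Decidable using (_⊎-dec_; decidable-stable)
open import Relation.Binary.PropositionalEquality
open import Relation.Binary.Definitions using (tri<; tri≈; tri>)

-- A record rather than d ∣ x - y, so that x and y can be inferred from the type.
infix 4 _≡_mod_
record _≡_mod_ (x y d : ℤ) : Set where
  constructor ≡mod
  field ∣-diff : d ∣ x -ℤ y

open _≡_mod_ public

module _ {d : ℤ} where

  ≡mod-reflexive : ∀ {x y} → x ≡ y → x ≡ y mod d
  ≡mod-reflexive {x} refl = ≡mod (divides 0ℤ (x-x≡0 x))
    where
    x-x≡0 : ∀ x → x -ℤ x ≡ 0ℤ *ℤ d
    x-x≡0 = solve-∀

  ≡mod-sym : ∀ {x y} → x ≡ y mod d → y ≡ x mod d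
  ≡mod-sym {x} {y} (≡mod d∣x-y) = ≡mod (subst (d ∣_) (identity x y) (∣m⇒∣-m d∣x-y))
    where
    identity : ∀ x y → - (x -ℤ y) ≡ y -ℤ x
    identity = solve-∀

  ≡mod-trans : ∀ {x y z} → x ≡ y mod d → y ≡ z mod d → x ≡ z mod d
  ≡mod-trans {x} {y} {z} (≡mod d∣x-y) (≡mod d∣y-z) =
    ≡mod (subst (d ∣_) (identity x y z) (∣m∣n⇒∣m+n d∣x-y d∣y-z))
    where
    identity : ∀ x y z → (x -ℤ y) +ℤ (y -ℤ z) ≡ x -ℤ z
    identity = solve-∀

  ≡mod-neg : ∀ {x y} → x ≡ y mod d → - x ≡ - y mod d
  ≡mod-neg {x} {y} (≡mod d∣x-y) = ≡mod (subst (d ∣_) (identity x y) (∣m⇒∣-m d∣x-y))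
    where
    identity : ∀ x y → - (x -ℤ y) ≡ - x -ℤ - y
    identity = solve-∀

  ≡mod-+ : ∀ {x y u v} → x ≡ y mod d → u ≡ v mod d → x +ℤ u ≡ y +ℤ v mod d
  ≡mod-+ {x} {y} {u} {v} (≡mod d∣x-y) (≡mod d∣u-v) =
    ≡mod (subst (d ∣_) (identity x y u v) (∣m∣n⇒∣m+n d∣x-y d∣u-v))
    where
    identity : ∀ x y u v → (x -ℤ y) +ℤ (u -ℤ v) ≡ (x +ℤ u) -ℤ (y +ℤ v)
    identity = solve-∀

  ≡mod-*ʳ : ∀ {x y} z → x ≡ y mod d → x *ℤ z ≡ y *ℤ z mod d
  ≡mod-*ʳ {x} {y} z (≡mod d∣x-y) = ≡mod (subst (d ∣_) (identity x y z) (∣m⇒∣m*n z d∣x-y))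
    where
    identity : ∀ x y z → (x -ℤ y) *ℤ z ≡ x *ℤ z -ℤ y *ℤ z
    identity = solve-∀

  ∣-resp-≡mod : ∀ {x y} → x ≡ y mod d → d ∣ x → d ∣ y
  ∣-resp-≡mod {x} {y} (≡mod d∣x-y) d∣x =
    subst (d ∣_) (identity x y) (∣m∣n⇒∣m+n (∣m⇒∣-m d∣x-y) d∣x)
    where
    identity : ∀ x y → - (x -ℤ y) +ℤ x ≡ y
    identity = solve-∀

  ∣+⇒≡-mod : ∀ {x} y {z} → d ∣ x +ℤ y → y ≡ z mod d → x ≡ - z mod d
  ∣+⇒≡-mod {x} y d∣x+y y≡z =
    ≡mod-trans (≡mod (subst (d ∣_) (cong (x +ℤ_) (sym (ℤ.neg-involutive y))) d∣x+y)) (≡mod-neg y≡z)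

+≡0⇒≡-mod : ∀ {d x y} → x +ℤ y ≡ 0ℤ mod d → y ≡ - x mod d
+≡0⇒≡-mod {d} {x} {y} (≡mod d∣x+y-0) = ≡mod (subst (d ∣_) (identity x y) d∣x+y-0)
  where
  identity : ∀ x y → x +ℤ y -ℤ 0ℤ ≡ y -ℤ - x
  identity = solve-∀

≡mod⇒∣+ : ∀ {d x y} c → x ≡ c mod d → y ≡ - c mod d → d ∣ x +ℤ y
≡mod⇒∣+ {d} {x} {y} c x≡c y≡-c =
  subst (d ∣_) (cong (x +ℤ_) (ℤ.neg-involutive y)) (∣-diff x≡-y)
  where
  x≡-y : x ≡ - y mod d
  x≡-y = ≡mod-trans x≡c (≡mod-trans (≡mod-reflexive (sym (ℤ.neg-involutive c))) (≡mod-sym (≡mod-neg y≡-c)))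

∤⇒∤-self : ∀ {d x} → ¬ d ∣ x → ¬ d ∣ x -ℤ d
∤⇒∤-self d∤x d∣x-d = d∤x (∣-resp-≡mod (≡mod-sym (≡mod d∣x-d)) ∣-refl)

∤⇒∤+self : ∀ {d x} → ¬ d ∣ x → ¬ d ∣ x +ℤ d
∤⇒∤+self d∤x d∣x+d = d∤x (∣m+n∣n⇒∣m d∣x+d ∣-refl)

≡mod-weaken : ∀ {k d x y} → k ∣ d → x ≡ y mod d → x ≡ y mod k
≡mod-weaken k∣d (≡mod d∣x-y) = ≡mod (∣-trans k∣d d∣x-y)

%≡%⇒≡mod : ∀ d .{{_ : NonZero d}} x y → x % d ≡ y % d → + x ≡ + y mod + d
%≡%⇒≡mod d x y x%d≡y%d = ≡mod $ divides (+ (x / d) -ℤ + (y / d)) (begin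
    + x -ℤ + y
      ≡⟨ cong₂ _-ℤ_ (a≡a%ℕn+[a/ℕn]*n (+ x) d) (a≡a%ℕn+[a/ℕn]*n (+ y) d) ⟩
    (+ (x % d) +ℤ + (x / d) *ℤ + d) -ℤ (+ (y % d) +ℤ + (y / d) *ℤ + d)
      ≡⟨ cong (λ r → (+ r +ℤ + (x / d) *ℤ + d) -ℤ (+ (y % d) +ℤ + (y / d) *ℤ + d)) x%d≡y%d ⟩
    (+ (y % d) +ℤ + (x / d) *ℤ + d) -ℤ (+ (y % d) +ℤ + (y / d) *ℤ + d)
      ≡⟨ identity (+ (y % d)) (+ (x / d)) (+ (y / d)) (+ d) ⟩
    (+ (x / d) -ℤ + (y / d)) *ℤ + d ∎)
  where
  open ≡-Reasoning
  identity : ∀ r a b d → (r +ℤ a *ℤ d) -ℤ (r +ℤ b *ℤ d) ≡ (a -ℤ b) *ℤ d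
  identity = solve-∀

≤∧≡mod⇒%≡% : ∀ d .{{_ : NonZero d}} {x y} → y ≤ x → + x ≡ + y mod + d → x % d ≡ y % d
≤∧≡mod⇒%≡% d {x} {y} y≤x x≡y = begin
    x % d              ≡⟨ cong (_% d) (m+[n∸m]≡n y≤x) ⟨
    (y + (x ∸ y)) % d  ≡⟨ %-remove-+ʳ y (∣⇒∣ᵤ d∣x∸y) ⟩
    y % d              ∎
  where
  open ≡-Reasoning
  d∣x∸y : + d ∣ + (x ∸ y)
  d∣x∸y = subst (+ d ∣_) (trans (ℤ.m-n≡m⊖n x y) (ℤ.⊖-≥ y≤x)) (∣-diff x≡y)

≡mod⇒%≡% : ∀ d .{{_ : NonZero d}} x y → + x ≡ + y mod + d → x % d ≡ y % d
≡mod⇒%≡% d x y x≡y with ≤-total y x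
... | inj₁ y≤x = ≤∧≡mod⇒%≡% d y≤x x≡y
... | inj₂ x≤y = sym (≤∧≡mod⇒%≡% d x≤y (≡mod-sym x≡y))

±2-apart : ∀ {q} x → ¬ q ∣ + 4 → x ≡ + 2 mod q → x ≡ - + 2 mod q → ⊥
±2-apart x q∤4 x≡2 x≡-2 = q∤4 (∣-diff (≡mod-trans (≡mod-sym x≡2) x≡-2))

module PlusMinusTwo {q₁ q₂ : ℤ} (q₁∤4 : ¬ q₁ ∣ + 4) (q₂∤4 : ¬ q₂ ∣ + 4) where

  infix 4 Q∣_
  Q∣_ : ℤ → Set
  Q∣ z = q₁ ∣ z ⊎ q₂ ∣ z

  Q∣-stable : ∀ {z} → ¬ ¬ Q∣ z → Q∣ z
  Q∣-stable {z} = decidable-stable ((q₁ ∣? z) ⊎-dec (q₂ ∣? z))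

  Crossed : ℤ → Set
  Crossed a = (a ≡ + 2 mod q₁ × a ≡ - + 2 mod q₂) ⊎ (a ≡ - + 2 mod q₁ × a ≡ + 2 mod q₂)

  Aligned : ℤ → Set
  Aligned s = (s ≡ + 2 mod q₁ × s ≡ + 2 mod q₂) ⊎ (s ≡ - + 2 mod q₁ × s ≡ - + 2 mod q₂)

  crossed : ∀ {a} → Q∣ a -ℤ + 2 → Q∣ a +ℤ + 2 → Crossed a
  crossed {a} (inj₁ q₁∣a-2) (inj₁ q₁∣a+2) = ⊥-elim (±2-apart a q₁∤4 (≡mod q₁∣a-2) (≡mod q₁∣a+2))
  crossed {a} (inj₁ q₁∣a-2) (inj₂ q₂∣a+2) = inj₁ (≡mod q₁∣a-2 , ≡mod q₂∣a+2)
  crossed {a} (inj₂ q₂∣a-2) (inj₁ q₁∣a+2) = inj₂ (≡mod q₁∣a+2 , ≡mod q₂∣a-2)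
  crossed {a} (inj₂ q₂∣a-2) (inj₂ q₂∣a+2) = ⊥-elim (±2-apart a q₂∤4 (≡mod q₂∣a-2) (≡mod q₂∣a+2))

  aligned : ∀ {s a} → Crossed a → Q∣ s +ℤ a → Q∣ s -ℤ a → Aligned s
  aligned {s} {a} (inj₁ (a≡2 , a≡-2)) (inj₁ q₁∣s+a) (inj₁ q₁∣s-a) =
    ⊥-elim (±2-apart s q₁∤4 (≡mod-trans (≡mod q₁∣s-a) a≡2) (∣+⇒≡-mod a q₁∣s+a a≡2))
  aligned {s} {a} (inj₁ (a≡2 , a≡-2)) (inj₁ q₁∣s+a) (inj₂ q₂∣s-a) =
    inj₂ (∣+⇒≡-mod a q₁∣s+a a≡2 , ≡mod-trans (≡mod q₂∣s-a) a≡-2)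
  aligned {s} {a} (inj₁ (a≡2 , a≡-2)) (inj₂ q₂∣s+a) (inj₁ q₁∣s-a) =
    inj₁ (≡mod-trans (≡mod q₁∣s-a) a≡2 , ∣+⇒≡-mod a q₂∣s+a a≡-2)
  aligned {s} {a} (inj₁ (a≡2 , a≡-2)) (inj₂ q₂∣s+a) (inj₂ q₂∣s-a) =
    ⊥-elim (±2-apart s q₂∤4 (∣+⇒≡-mod a q₂∣s+a a≡-2) (≡mod-trans (≡mod q₂∣s-a) a≡-2))
  aligned {s} {a} (inj₂ (a≡-2 , a≡2)) (inj₁ q₁∣s+a) (inj₁ q₁∣s-a) =
    ⊥-elim (±2-apart s q₁∤4 (∣+⇒≡-mod a q₁∣s+a a≡-2) (≡mod-trans (≡mod q₁∣s-a) a≡-2))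
  aligned {s} {a} (inj₂ (a≡-2 , a≡2)) (inj₁ q₁∣s+a) (inj₂ q₂∣s-a) =
    inj₁ (∣+⇒≡-mod a q₁∣s+a a≡-2 , ≡mod-trans (≡mod q₂∣s-a) a≡2)
  aligned {s} {a} (inj₂ (a≡-2 , a≡2)) (inj₂ q₂∣s+a) (inj₁ q₁∣s-a) =
    inj₂ (≡mod-trans (≡mod q₁∣s-a) a≡-2 , ∣+⇒≡-mod a q₂∣s+a a≡2)
  aligned {s} {a} (inj₂ (a≡-2 , a≡2)) (inj₂ q₂∣s+a) (inj₂ q₂∣s-a) =
    ⊥-elim (±2-apart s q₂∤4 (≡mod-trans (≡mod q₂∣s-a) a≡2) (∣+⇒≡-mod a q₂∣s+a a≡2))

  crossed-aligned⇒Q∣ : ∀ {b s} → Crossed b → Aligned s → Q∣ b +ℤ s × Q∣ s -ℤ b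
  crossed-aligned⇒Q∣ (inj₁ (b≡2 , b≡-2)) (inj₁ (s≡2 , s≡2′)) =
    inj₂ (≡mod⇒∣+ (- + 2) b≡-2 s≡2′) , inj₁ (∣-diff (≡mod-trans s≡2 (≡mod-sym b≡2)))
  crossed-aligned⇒Q∣ (inj₁ (b≡2 , b≡-2)) (inj₂ (s≡-2 , s≡-2′)) =
    inj₁ (≡mod⇒∣+ (+ 2) b≡2 s≡-2) , inj₂ (∣-diff (≡mod-trans s≡-2′ (≡mod-sym b≡-2)))
  crossed-aligned⇒Q∣ (inj₂ (b≡-2 , b≡2)) (inj₁ (s≡2 , s≡2′)) =
    inj₁ (≡mod⇒∣+ (- + 2) b≡-2 s≡2) , inj₂ (∣-diff (≡mod-trans s≡2′ (≡mod-sym b≡2)))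
  crossed-aligned⇒Q∣ (inj₂ (b≡-2 , b≡2)) (inj₂ (s≡-2 , s≡-2′)) =
    inj₂ (≡mod⇒∣+ (+ 2) b≡2 s≡-2′) , inj₁ (∣-diff (≡mod-trans s≡-2 (≡mod-sym b≡-2)))

prime∤1 : ∀ {q} → Prime q → ¬ + q ∣ + 1
prime∤1 q-prime q∣1 = nonTrivial⇒≢1 {{prime⇒nonTrivial q-prime}} (∣1⇒≡1 (∣⇒∣ᵤ q∣1))

odd-prime∤4 : ∀ {q} → Prime q → q ≢ 2 → ¬ + q ∣ + 4
odd-prime∤4 {q} q-prime q≢2 q∣4 = [ q∤2 , q∤2 ]′ (euclidsLemma 2 2 q-prime (∣⇒∣ᵤ q∣4))
  where
  q∤2 : ¬ q ℕ.∣ 2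
  q∤2 q∣2 = [ nonTrivial⇒≢1 {{prime⇒nonTrivial q-prime}} , q≢2 ]′ (prime⇒irreducible prime[2] q∣2)

prime∤⇒coprime : ∀ {q e} → Prime q → ¬ q ℕ.∣ e → Coprime e q
prime∤⇒coprime q-prime q∤e (d∣e , d∣q) with prime⇒irreducible q-prime d∣q
... | inj₁ d≡1 = d≡1
... | inj₂ refl = ⊥-elim (q∤e d∣e)

coprime-*ʳ : ∀ {a b c} → Coprime a b → Coprime a c → Coprime a (b * c)
coprime-*ʳ coprime-ab coprime-ac (d∣a , d∣bc) =
  coprime-ac (d∣a , coprime-divisor (λ (k∣d , k∣b) → coprime-ab (ℕ.∣-trans k∣d d∣a , k∣b)) d∣bc)

coprime-^ʳ : ∀ {a b} → Coprime a b → ∀ j → Coprime a (b ^ j)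
coprime-^ʳ _          zero    (_ , d∣1) = ∣1⇒≡1 d∣1
coprime-^ʳ coprime-ab (suc j) = coprime-*ʳ coprime-ab (coprime-^ʳ coprime-ab j)

%-distribˡ-^ : ∀ x k d .{{_ : NonZero d}} → (x % d) ^ k % d ≡ x ^ k % d
%-distribˡ-^ x zero    d = refl
%-distribˡ-^ x (suc k) d = begin
    (x % d) * (x % d) ^ k % d            ≡⟨ %-distribˡ-* (x % d) ((x % d) ^ k) d ⟩
    (x % d % d) * ((x % d) ^ k % d) % d  ≡⟨ cong₂ (λ u v → u * v % d) (m%n%n≡m%n x d) (%-distribˡ-^ x k d) ⟩
    (x % d) * (x ^ k % d) % d            ≡⟨ %-distribˡ-* x (x ^ k) d ⟨
    x * x ^ k % d                        ∎
  where open ≡-Reasoning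

m+m≡m*2 : ∀ m → m + m ≡ m * 2
m+m≡m*2 m = trans (cong (λ u → m + u) (sym (*-identityʳ m))) (sym (*-suc m 1))

pos-suc : ∀ s → + suc s ≡ + s +ℤ + 1
pos-suc s = cong +_ (+-comm 1 s)

parity : ∀ s → + 2 ∣ + s ⊎ + 2 ∣ + suc s
parity zero    = inj₁ (divides 0ℤ refl)
parity (suc s) = [ inj₂ ∘ add-two , inj₁ ]′ (parity s)
  where
  add-two : + 2 ∣ + s → + 2 ∣ + suc (suc s)
  add-two 2∣s = subst (λ k → + 2 ∣ + k) (+-comm s 2) (∣m∣n⇒∣m+n 2∣s (divides (+ 1) refl))

odd⇒even-pred : ∀ s → ¬ + 2 ∣ + suc s → + 2 ∣ + s
odd⇒even-pred s odd = [ id , ⊥-elim ∘ odd ]′ (parity s)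

odd⇒even-suc : ∀ s → ¬ + 2 ∣ + s → + 2 ∣ + suc s
odd⇒even-suc s odd = [ ⊥-elim ∘ odd , id ]′ (parity s)

coprime⇒invertible : ∀ {e m} → Coprime e (suc m) → ∃[ t ] + (e * t) ≡ + 1 mod + suc m
coprime⇒invertible {e} {m} coprime with coprime-Bézout coprime
... | Bézout.+- x y 1+yn≡xe = x , ≡mod (divides (+ y) (begin
    + (e * x) -ℤ + 1       ≡⟨ cong (λ k → + k -ℤ + 1) (trans (*-comm e x) (sym 1+yn≡xe)) ⟩
    + (1 + y * n) -ℤ + 1   ≡⟨ cong (_-ℤ + 1) (ℤ.pos-+ 1 (y * n)) ⟩
    + 1 +ℤ + (y * n) -ℤ + 1 ≡⟨ cong (λ k → + 1 +ℤ k -ℤ + 1) (ℤ.pos-* y n) ⟩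
    + 1 +ℤ + y *ℤ + n -ℤ + 1 ≡⟨ identity (+ y) (+ n) ⟩
    + y *ℤ + n             ∎))
  where
  open ≡-Reasoning
  n : ℕ
  n = suc m
  identity : ∀ y n → + 1 +ℤ y *ℤ n -ℤ + 1 ≡ y *ℤ n
  identity = solve-∀
... | Bézout.-+ x y 1+xe≡yn = x * m , ≡mod (divides (+ y *ℤ + m -ℤ + 1) (begin
    + (e * (x * m)) -ℤ + 1                     ≡⟨ cong (_-ℤ + 1) (cast e x m) ⟩
    + e *ℤ (+ x *ℤ + m) -ℤ + 1                 ≡⟨ identity₁ (+ e) (+ x) (+ m) ⟩
    (+ 1 +ℤ + x *ℤ + e) *ℤ + m -ℤ (+ 1 +ℤ + m) ≡⟨ cong (λ k → k *ℤ + m -ℤ (+ 1 +ℤ + m)) lifted ⟩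
    + y *ℤ (+ 1 +ℤ + m) *ℤ + m -ℤ (+ 1 +ℤ + m) ≡⟨ identity₂ (+ y) (+ m) ⟩
    (+ y *ℤ + m -ℤ + 1) *ℤ (+ 1 +ℤ + m)       ∎))
  where
  open ≡-Reasoning
  cast : ∀ a b c → + (a * (b * c)) ≡ + a *ℤ (+ b *ℤ + c)
  cast a b c = trans (ℤ.pos-* a (b * c)) (cong (+ a *ℤ_) (ℤ.pos-* b c))
  lifted : + 1 +ℤ + x *ℤ + e ≡ + y *ℤ (+ 1 +ℤ + m)
  lifted = begin
    + 1 +ℤ + x *ℤ + e  ≡⟨ cong (+ 1 +ℤ_) (ℤ.pos-* x e) ⟨
    + (1 + x * e)      ≡⟨ cong +_ 1+xe≡yn ⟩
    + (y * suc m)      ≡⟨ ℤ.pos-* y (suc m) ⟩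
    + y *ℤ (+ 1 +ℤ + m) ∎
  identity₁ : ∀ e x m → e *ℤ (x *ℤ m) -ℤ + 1 ≡ (+ 1 +ℤ x *ℤ e) *ℤ m -ℤ (+ 1 +ℤ m)
  identity₁ = solve-∀
  identity₂ : ∀ y m → y *ℤ (+ 1 +ℤ m) *ℤ m -ℤ (+ 1 +ℤ m) ≡ (y *ℤ m -ℤ + 1) *ℤ (+ 1 +ℤ m)
  identity₂ = solve-∀

-- p = 2 + m, so that the group order n = p − 1 = 1 + m is definitionally a successor.
module PowersOfGenerator {m : ℕ} (p-prime : Prime (2 + m)) {g : ℕ} (g-gen : Gen (2 + m) g) where

  p n : ℕ
  p = 2 + m
  n = 1 + m

  pow : ℕ → ℕ
  pow e = g ^ e % p

  log : ∀ y → Unit p y → ∃[ k ] pow k ≡ y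
  log = proj₂ g-gen

  pow-1 : pow 1 ≡ g
  pow-1 = trans (cong (_% p) (*-identityʳ g)) (m<n⇒m%n≡m (proj₂ (proj₁ g-gen)))

  pow-+ : ∀ x y → pow (x + y) ≡ pow x * pow y % p
  pow-+ x y = trans (cong (_% p) (^-distribˡ-+-* g x y)) (%-distribˡ-* (g ^ x) (g ^ y) p)

  pow-suc : ∀ s → pow (suc s) ≡ g * pow s % p
  pow-suc s = trans (pow-+ 1 s) (cong (λ u → u * pow s % p) pow-1)

  IsInv-g⇒IsInv-pow-1 : ∀ {h} → IsInv p g h → IsInv p (pow 1) h
  IsInv-g⇒IsInv-pow-1 {h} = subst (λ u → IsInv p u h) (sym pow-1)

  pow-^ : ∀ e k → pow e ^ k % p ≡ pow (e * k)
  pow-^ e k = trans (%-distribˡ-^ (g ^ e) k p) (cong (_% p) (^-*-assoc g e k))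

  coprime-p-g^ : ∀ e → Coprime p (g ^ e)
  coprime-p-g^ = coprime-^ʳ (prime⇒coprime p-prime {{>-nonZero (proj₁ (proj₁ g-gen))}} (proj₂ (proj₁ g-gen)))

  pow-unit : ∀ e → Unit p (pow e)
  pow-unit e = n≢0⇒n>0 (p∤g^e ∘ ℕ.m%n≡0⇒n∣m (g ^ e) p) , m%n<n (g ^ e) p
    where
    p∤g^e : ¬ p ℕ.∣ g ^ e
    p∤g^e p∣g^e = nonTrivial⇒≢1 {{prime⇒nonTrivial p-prime}} (coprime-p-g^ e (ℕ.∣-refl , p∣g^e))

  pow-cancelˡ : ∀ x {y z} → pow (x + y) ≡ pow (x + z) → pow y ≡ pow z
  pow-cancelˡ x {y} {z} eq = ≡mod⇒%≡% p (g ^ y) (g ^ z) (≡mod p∣Y-Z)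
    where
    X Y Z : ℕ
    X = g ^ x
    Y = g ^ y
    Z = g ^ z
    XY≡XZ : X * Y % p ≡ X * Z % p
    XY≡XZ = trans (cong (_% p) (sym (^-distribˡ-+-* g x y))) (trans eq (cong (_% p) (^-distribˡ-+-* g x z)))
    factor : + (X * Y) -ℤ + (X * Z) ≡ + X *ℤ (+ Y -ℤ + Z)
    factor = trans (cong₂ _-ℤ_ (ℤ.pos-* X Y) (ℤ.pos-* X Z)) (identity (+ X) (+ Y) (+ Z))
      where
      identity : ∀ x y z → x *ℤ y -ℤ x *ℤ z ≡ x *ℤ (y -ℤ z)
      identity = solve-∀
    p∣Y-Z : + p ∣ + Y -ℤ + Z
    p∣Y-Z = ∣ᵤ⇒∣ (ℤ.coprime-divisor (+ p) (+ X) _ (coprime-p-g^ x)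
              (∣⇒∣ᵤ (subst (+ p ∣_) factor (∣-diff (%≡%⇒≡mod p (X * Y) (X * Z) XY≡XZ)))))

  pow-periodic : ∀ {d} → pow d ≡ 1 → ∀ x k → pow (x + k * d) ≡ pow x
  pow-periodic pd x zero    = cong pow (+-identityʳ x)
  pow-periodic {d} pd x (suc k) = begin
    pow (x + (d + k * d))      ≡⟨ cong pow (x+[d+y]≡d+[x+y] x d (k * d)) ⟩
    pow (d + (x + k * d))      ≡⟨ pow-+ d (x + k * d) ⟩
    pow d * pow (x + k * d) % p ≡⟨ cong (λ u → u * pow (x + k * d) % p) pd ⟩
    1 * pow (x + k * d) % p    ≡⟨ cong (_% p) (*-identityˡ (pow (x + k * d))) ⟩
    pow (x + k * d) % p        ≡⟨ m%n%n≡m%n (g ^ (x + k * d)) p ⟩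
    pow (x + k * d)            ≡⟨ pow-periodic pd x k ⟩
    pow x                      ∎
    where
    open ≡-Reasoning
    x+[d+y]≡d+[x+y] : ∀ x d y → x + (d + y) ≡ d + (x + y)
    x+[d+y]≡d+[x+y] x d y = trans (sym (+-assoc x d y)) (trans (cong (_+ y) (+-comm x d)) (+-assoc d x y))

  pow-% : ∀ {d} .{{_ : NonZero d}} → pow d ≡ 1 → ∀ x → pow (x % d) ≡ pow x
  pow-% {d} pd x = trans (sym (pow-periodic pd (x % d) (x / d))) (cong pow (sym (m≡m%n+[m/n]*n x d)))

  pow-∸ : ∀ {x y} → x ≤ y → pow x ≡ pow y → pow (y ∸ x) ≡ 1
  pow-∸ {x} {y} x≤y eq = sym (pow-cancelˡ x (begin
    pow (x + 0)       ≡⟨ cong pow (+-identityʳ x) ⟩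
    pow x             ≡⟨ eq ⟩
    pow y             ≡⟨ cong pow (m+[n∸m]≡n x≤y) ⟨
    pow (x + (y ∸ x)) ∎))
    where open ≡-Reasoning

  unit-index : ∀ {y} → Unit p y → Fin n
  unit-index {suc y} (_ , s≤s y<n) = fromℕ< y<n

  unit-index-injective : ∀ {y z} (u : Unit p y) (v : Unit p z) → unit-index u ≡ unit-index v → y ≡ z
  unit-index-injective {suc y} {suc z} (_ , s≤s y<n) (_ , s≤s z<n) eq =
    cong suc (trans (sym (Fin.toℕ-fromℕ< y<n)) (trans (cong toℕ eq) (Fin.toℕ-fromℕ< z<n)))

  n≤period : ∀ {d} → 0 < d → pow d ≡ 1 → n ≤ d
  n≤period {d@(suc _)} _ pd = Fin.injective⇒≤ residue-injective
    where
    index : Fin n → ℕ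
    index i = proj₁ (log (suc (toℕ i)) (s≤s z≤n , s≤s (Fin.toℕ<n i)))
    residue : Fin n → Fin d
    residue i = fromℕ< (m%n<n (index i) d)
    pow-residue : ∀ i → pow (toℕ (residue i)) ≡ suc (toℕ i)
    pow-residue i = trans (cong pow (Fin.toℕ-fromℕ< (m%n<n (index i) d)))
                      (trans (pow-% pd (index i)) (proj₂ (log _ _)))
    residue-injective : ∀ {i j} → residue i ≡ residue j → i ≡ j
    residue-injective {i} {j} eq = Fin.toℕ-injective (suc-injective
      (trans (sym (pow-residue i)) (trans (cong (pow ∘ toℕ) eq) (pow-residue j))))

  pow-n≡1 : pow n ≡ 1
  pow-n≡1 with Fin.pigeonhole (n<1+n n) (λ k → unit-index (pow-unit (toℕ k)))
  ... | i , j , i<j , eq = subst (λ d → pow d ≡ 1) d≡n pd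
    where
    d : ℕ
    d = toℕ j ∸ toℕ i
    pd : pow d ≡ 1
    pd = pow-∸ (<⇒≤ i<j) (unit-index-injective (pow-unit (toℕ i)) (pow-unit (toℕ j)) eq)
    d≡n : d ≡ n
    d≡n = ≤-antisym (≤-trans (m∸n≤m (toℕ j) (toℕ i)) (s≤s⁻¹ (Fin.toℕ<n j)))
                    (n≤period (m<n⇒0<n∸m i<j) pd)

  pow-collision⇒n≤ : ∀ {x y} → x < y → pow x ≡ pow y → n ≤ y
  pow-collision⇒n≤ {x} {y} x<y eq = ≤-trans (n≤period (m<n⇒0<n∸m x<y) (pow-∸ (<⇒≤ x<y) eq)) (m∸n≤m y x)

  pow-injective-below : ∀ {x y} → x < n → y < n → pow x ≡ pow y → x ≡ y
  pow-injective-below {x} {y} x<n y<n eq with <-cmp x y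
  ... | tri< x<y _ _ = ⊥-elim (<⇒≱ y<n (pow-collision⇒n≤ x<y eq))
  ... | tri≈ _ x≡y _ = x≡y
  ... | tri> _ _ y<x = ⊥-elim (<⇒≱ x<n (pow-collision⇒n≤ y<x (sym eq)))

  pow-≡⇒≡mod : ∀ x y → pow x ≡ pow y → + x ≡ + y mod + n
  pow-≡⇒≡mod x y eq = %≡%⇒≡mod n x y (pow-injective-below (m%n<n x n) (m%n<n y n)
    (trans (pow-% pow-n≡1 x) (trans eq (sym (pow-% pow-n≡1 y)))))

  ≡mod⇒pow-≡ : ∀ {x y} → + x ≡ + y mod + n → pow x ≡ pow y
  ≡mod⇒pow-≡ {x} {y} x≡y =
    trans (sym (pow-% pow-n≡1 x)) (trans (cong pow (≡mod⇒%≡% n x y x≡y)) (pow-% pow-n≡1 y))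

  gen-pow⇒∃inverse : ∀ {e} → Gen p (pow e) → ∃[ t ] + (e * t) ≡ + 1 mod + n
  gen-pow⇒∃inverse {e} (_ , surjective) with surjective g (proj₁ g-gen)
  ... | t , pow-e^t≡g = t , pow-≡⇒≡mod (e * t) 1 (trans (sym (pow-^ e t)) (trans pow-e^t≡g (sym pow-1)))

  ∃inverse⇒gen-pow : ∀ e t → + (e * t) ≡ + 1 mod + n → Gen p (pow e)
  ∃inverse⇒gen-pow e t et≡1 = pow-unit e , λ y y-unit →
    let (k , pk≡y) = log y y-unit in t * k , (begin
      pow e ^ (t * k) % p ≡⟨ pow-^ e (t * k) ⟩
      pow (e * (t * k))   ≡⟨ cong pow (*-assoc e t k) ⟨
      pow (e * t * k)     ≡⟨ ≡mod⇒pow-≡ (etk≡k k) ⟩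
      pow k               ≡⟨ pk≡y ⟩
      y                   ∎)
    where
    open ≡-Reasoning
    etk≡k : ∀ k → + (e * t * k) ≡ + k mod + n
    etk≡k k = subst₂ (λ u v → u ≡ v mod + n) (sym (ℤ.pos-* (e * t) k)) (ℤ.*-identityˡ (+ k))
                (≡mod-*ʳ (+ k) et≡1)

  gen-pow⇒coprime : ∀ {e d} → Gen p (pow e) → d ∣ + n → d ∣ + e → d ∣ + 1
  gen-pow⇒coprime {e} {d} gen d∣n d∣e = from-inverse (gen-pow⇒∃inverse {e} gen)
    where
    from-inverse : ∃[ t ] + (e * t) ≡ + 1 mod + n → d ∣ + 1
    from-inverse (t , et≡1) =
      ∣-resp-≡mod (≡mod-weaken d∣n et≡1) (subst (d ∣_) (sym (ℤ.pos-* e t)) (∣m⇒∣m*n (+ t) d∣e))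

  qr-pow⇒even : ∀ {e} → + 2 ∣ + n → QR p (pow e) → + 2 ∣ + e
  qr-pow⇒even {e} 2∣n (_ , x , x²≡pow-e) = ∣-resp-≡mod (≡mod-weaken 2∣n 2k≡e) 2∣2k
    where
    x²≡ : ∀ x → x * x % p ≡ (x % p) * (x % p) % p
    x²≡ x = %-distribˡ-* x x p
    x-unit : Unit p (x % p)
    x-unit = n≢0⇒n>0 (λ x%p≡0 → <⇒≱ (proj₁ (pow-unit e))
               (≤-reflexive (trans (sym x²≡pow-e) (trans (x²≡ x) (cong (λ u → u * u % p) x%p≡0))))) ,
             m%n<n x p
    k : ℕ
    k = proj₁ (log (x % p) x-unit)
    2k≡e : + (k + k) ≡ + e mod + n
    2k≡e = pow-≡⇒≡mod (k + k) e (begin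
      pow (k + k)               ≡⟨ pow-+ k k ⟩
      pow k * pow k % p         ≡⟨ cong (λ u → u * u % p) (proj₂ (log (x % p) x-unit)) ⟩
      (x % p) * (x % p) % p     ≡⟨ x²≡ x ⟨
      x * x % p                 ≡⟨ x²≡pow-e ⟩
      pow e                     ∎)
      where open ≡-Reasoning
    2∣2k : + 2 ∣ + (k + k)
    2∣2k = divides (+ k) (trans (cong +_ (m+m≡m*2 k)) (ℤ.pos-* k 2))

  even⇒qr-pow : ∀ {e} → + 2 ∣ + e → QR p (pow e)
  even⇒qr-pow {e} 2∣e with ∣⇒∣ᵤ 2∣e
  ... | ℕ.divides j e≡j*2 = pow-unit e , g ^ j , (begin
    g ^ j * g ^ j % p ≡⟨ cong (_% p) (^-distribˡ-+-* g j j) ⟨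
    pow (j + j)       ≡⟨ cong pow (trans (m+m≡m*2 j) (sym e≡j*2)) ⟩
    pow e             ∎)
    where open ≡-Reasoning

  inverse-exponent : ∀ a {h} → IsInv p (pow a) h → ∃[ c ] pow c ≡ h × (+ c ≡ - + a mod + n)
  inverse-exponent a {h} (h-unit , ah≡1) with log h h-unit
  ... | c , pc≡h = c , pc≡h , +≡0⇒≡-mod (subst (λ u → u ≡ 0ℤ mod + n) (ℤ.pos-+ a c)
          (pow-≡⇒≡mod (a + c) 0 (trans (pow-+ a c) (trans (cong (λ u → pow a * u % p) pc≡h) ah≡1))))

  pow-inverse : ∀ a → IsInv p (pow a) (pow (a * m))
  pow-inverse a = pow-unit (a * m) , (begin
    pow a * pow (a * m) % p ≡⟨ pow-+ a (a * m) ⟨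
    pow (a + a * m)         ≡⟨ cong pow (*-suc a m) ⟨
    pow (a * n)             ≡⟨ pow-periodic pow-n≡1 0 a ⟩
    1                       ∎)
    where open ≡-Reasoning

q∣q^ : ∀ q {j} → 1 ≤ j → q ℕ.∣ q ^ j
q∣q^ q {suc j} _ = m∣m*n (q ^ j)

module TwoOddPrimes
  {m : ℕ} (p-prime : Prime (2 + m)) {g : ℕ} (g-gen : Gen (2 + m) g)
  {i j₁ j₂ q₁ q₂ : ℕ} (q₁-prime : Prime q₁) (q₂-prime : Prime q₂) (q₁≢2 : q₁ ≢ 2) (q₂≢2 : q₂ ≢ 2)
  (1≤i : 1 ≤ i) (1≤j₁ : 1 ≤ j₁) (1≤j₂ : 1 ≤ j₂) (n≡ : 1 + m ≡ 2 ^ i * q₁ ^ j₁ * q₂ ^ j₂)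
  where

  open PowersOfGenerator p-prime g-gen
  open PlusMinusTwo (odd-prime∤4 q₁-prime q₁≢2) (odd-prime∤4 q₂-prime q₂≢2)

  ∣n : ∀ {d} → d ℕ.∣ 2 ^ i * q₁ ^ j₁ * q₂ ^ j₂ → + d ∣ + n
  ∣n {d} d∣n = ∣ᵤ⇒∣ (subst (d ℕ.∣_) (sym n≡) d∣n)

  2∣n : + 2 ∣ + n
  2∣n = ∣n (ℕ.∣-trans (q∣q^ 2 1≤i) (ℕ.∣-trans (m∣m*n (q₁ ^ j₁)) (m∣m*n (q₂ ^ j₂))))

  q₁∣n : + q₁ ∣ + n
  q₁∣n = ∣n (ℕ.∣-trans (q∣q^ q₁ 1≤j₁) (n∣m*n*o (2 ^ i) (q₂ ^ j₂)))

  q₂∣n : + q₂ ∣ + n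
  q₂∣n = ∣n (ℕ.∣-trans (q∣q^ q₂ 1≤j₂) (n∣m*n (2 ^ i * q₁ ^ j₁)))

  Q∣-resp : ∀ {x y} → x ≡ y mod + n → Q∣ x → Q∣ y
  Q∣-resp x≡y = Sum.map (∣-resp-≡mod (≡mod-weaken q₁∣n x≡y)) (∣-resp-≡mod (≡mod-weaken q₂∣n x≡y))

  Invertible : ℤ → Set
  Invertible z = ¬ + 2 ∣ z × ¬ Q∣ z

  invertible-resp : ∀ {x y} → x ≡ y mod + n → Invertible x → Invertible y
  invertible-resp x≡y (x-odd , ¬Q∣x) =
    x-odd ∘ ∣-resp-≡mod (≡mod-weaken 2∣n (≡mod-sym x≡y)) , ¬Q∣x ∘ Q∣-resp (≡mod-sym x≡y)

  gen-pow⇒invertible : ∀ e → Gen p (pow e) → Invertible (+ e)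
  gen-pow⇒invertible e gen =
    prime∤1 prime[2] ∘ gen-pow⇒coprime gen 2∣n ,
    [ prime∤1 q₁-prime ∘ gen-pow⇒coprime gen q₁∣n , prime∤1 q₂-prime ∘ gen-pow⇒coprime gen q₂∣n ]′

  invertible⇒coprime : ∀ {e} → Invertible (+ e) → Coprime e n
  invertible⇒coprime {e} (e-odd , ¬Q∣e) = subst (Coprime e) (sym n≡) (coprime-*ʳ (coprime-*ʳ
    (coprime-^ʳ (prime∤⇒coprime prime[2] (e-odd ∘ ∣ᵤ⇒∣)) i)
    (coprime-^ʳ (prime∤⇒coprime q₁-prime (¬Q∣e ∘ inj₁ ∘ ∣ᵤ⇒∣)) j₁))
    (coprime-^ʳ (prime∤⇒coprime q₂-prime (¬Q∣e ∘ inj₂ ∘ ∣ᵤ⇒∣)) j₂))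

  gen-pow : ∀ e {z} → + e ≡ z mod + n → Invertible z → Gen p (pow e)
  gen-pow e e≡z invertible-z =
    let t , et≡1 = coprime⇒invertible (invertible⇒coprime {e} (invertible-resp (≡mod-sym e≡z) invertible-z))
    in ∃inverse⇒gen-pow e t et≡1

  ng-pow : ∀ e {z} → + e ≡ z mod + n → ¬ + 2 ∣ z → Q∣ z → NG p (pow e)
  ng-pow e e≡z z-odd Q∣z =
    pow-unit e ,
    z-odd ∘ ∣-resp-≡mod (≡mod-weaken 2∣n e≡z) ∘ qr-pow⇒even 2∣n ,
    λ gen → proj₂ (gen-pow⇒invertible e gen) (Q∣-resp (≡mod-sym e≡z) Q∣z)

  ng-pow⇒Q∣ : ∀ e {z} → NG p (pow e) → + e ≡ z mod + n → Q∣ z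
  ng-pow⇒Q∣ e (_ , ¬qr , ¬gen) e≡z = Q∣-resp e≡z (Q∣-stable λ ¬Q∣ →
    ¬gen (gen-pow e (≡mod-reflexive refl) (¬qr ∘ even⇒qr-pow , ¬Q∣)))

  inverse-times-pow : ∀ a {h} → IsInv p (pow a) h → ∀ s →
                      ∃[ e ] h * pow s % p ≡ pow e × (+ e ≡ + s -ℤ + a mod + n)
  inverse-times-pow a {h} inv s = shift (inverse-exponent a inv)
    where
    shift : ∃[ c ] pow c ≡ h × (+ c ≡ - + a mod + n) →
            ∃[ e ] h * pow s % p ≡ pow e × (+ e ≡ + s -ℤ + a mod + n)
    shift (c , pc≡h , c≡-a) =
      c + s ,
      trans (cong (λ u → u * pow s % p) (sym pc≡h)) (sym (pow-+ c s)) ,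
      subst₂ (λ u v → u ≡ v mod + n) (sym (ℤ.pos-+ c s)) (ℤ.+-comm (- + a) (+ s))
        (≡mod-+ c≡-a (≡mod-reflexive {x = + s} refl))

  pow∈I : ∀ s → + 2 ∣ + s → Invertible (+ s +ℤ + 1) → Invertible (+ s -ℤ + 1) → I p g (pow s)
  pow∈I s s-even invertible₊ invertible₋ = (qr , gen-g·r) , λ h h-inv → qr , gen-h·r h h-inv
    where
    qr : QR p (pow s)
    qr = even⇒qr-pow s-even
    gen-g·r : Gen p (g * pow s % p)
    gen-g·r = subst (Gen p) (pow-suc s)
                (gen-pow (1 + s) (≡mod-reflexive (pos-suc s)) invertible₊)
    gen-h·r : ∀ h → IsInv p g h → Gen p (h * pow s % p)
    gen-h·r h h-inv = from-exponent (inverse-times-pow 1 (IsInv-g⇒IsInv-pow-1 h-inv) s)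
      where
      from-exponent : ∃[ e ] h * pow s % p ≡ pow e × (+ e ≡ + s -ℤ + 1 mod + n) → Gen p (h * pow s % p)
      from-exponent (e , h·r≡pow-e , e≡s-1) = subst (Gen p) (sym h·r≡pow-e) (gen-pow e e≡s-1 invertible₋)

  ∈M⇒Q∣-2 : ∀ a → M p g (pow a) → Q∣ + a -ℤ + 2
  ∈M⇒Q∣-2 zero    (gen , _) = ⊥-elim (proj₁ (gen-pow⇒invertible 0 gen) (divides 0ℤ refl))
  ∈M⇒Q∣-2 (suc s) (gen , ∉M) = Q∣-stable λ ¬Q∣ →
    ∉M (pow s , pow∈I s s-even invertible₊ (invertible₋ ¬Q∣) , inj₁ (pow-suc s))
    where
    invertible-a : Invertible (+ suc s)
    invertible-a = gen-pow⇒invertible (suc s) gen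
    s-even : + 2 ∣ + s
    s-even = odd⇒even-pred s (proj₁ invertible-a)
    invertible₊ : Invertible (+ s +ℤ + 1)
    invertible₊ = invertible-resp (≡mod-reflexive (pos-suc s)) invertible-a
    a-2≡s-1 : + suc s -ℤ + 2 ≡ + s -ℤ + 1
    a-2≡s-1 = trans (cong (_-ℤ + 2) (pos-suc s)) (identity (+ s))
      where
      identity : ∀ s → s +ℤ + 1 -ℤ + 2 ≡ s -ℤ + 1
      identity = solve-∀
    invertible₋ : ¬ Q∣ + suc s -ℤ + 2 → Invertible (+ s -ℤ + 1)
    invertible₋ ¬Q∣ = invertible-resp (≡mod-reflexive a-2≡s-1) (∤⇒∤-self (proj₁ invertible-a) , ¬Q∣)

  ∈M⇒Q∣+2 : ∀ a → M p g (pow a) → Q∣ + a +ℤ + 2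
  ∈M⇒Q∣+2 a (gen , ∉M) = Q∣-stable λ ¬Q∣ →
    ∉M (pow (suc a) , pow∈I (suc a) (odd⇒even-suc a (proj₁ invertible-a)) (invertible₊ ¬Q∣) invertible₋ ,
        inj₂ λ h h-inv → from-exponent h (inverse-times-pow 1 (IsInv-g⇒IsInv-pow-1 h-inv) (suc a)))
    where
    invertible-a : Invertible (+ a)
    invertible-a = gen-pow⇒invertible a gen
    invertible₊ : ¬ Q∣ + a +ℤ + 2 → Invertible (+ suc a +ℤ + 1)
    invertible₊ ¬Q∣ = invertible-resp (≡mod-reflexive (cong +_ (+-suc a 1))) (∤⇒∤+self (proj₁ invertible-a) , ¬Q∣)
    a+1-1≡a : + suc a -ℤ + 1 ≡ + a
    a+1-1≡a = trans (cong (_-ℤ + 1) (pos-suc a)) (identity (+ a))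
      where
      identity : ∀ a → a +ℤ + 1 -ℤ + 1 ≡ a
      identity = solve-∀
    invertible₋ : Invertible (+ suc a -ℤ + 1)
    invertible₋ = invertible-resp (≡mod-reflexive (sym a+1-1≡a)) invertible-a
    from-exponent : ∀ h → ∃[ e ] h * pow (suc a) % p ≡ pow e × (+ e ≡ + suc a -ℤ + 1 mod + n) →
                    pow a ≡ h * pow (suc a) % p
    from-exponent h (e , h·r≡pow-e , e≡a) =
      sym (trans h·r≡pow-e (≡mod⇒pow-≡ (≡mod-trans e≡a (≡mod-reflexive a+1-1≡a))))

  m-exponent : ∀ a → M p g (pow a) → Invertible (+ a) × Crossed (+ a)
  m-exponent a a∈M = gen-pow⇒invertible a (proj₁ a∈M) , crossed (∈M⇒Q∣-2 a a∈M) (∈M⇒Q∣+2 a a∈M)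

  ni⇒aligned : ∀ a s → Crossed (+ a) → NI p (pow a) (pow s) → Aligned (+ s)
  ni⇒aligned a s crossed-a ((_ , ng-a·r) , ng-inverse·r) =
    aligned {+ s} {+ a} crossed-a Q∣s+a (from-exponent (inverse-times-pow a (pow-inverse a) s))
    where
    Q∣s+a : Q∣ + s +ℤ + a
    Q∣s+a = ng-pow⇒Q∣ (a + s) (subst (NG p) (sym (pow-+ a s)) ng-a·r)
              (≡mod-reflexive (trans (ℤ.pos-+ a s) (ℤ.+-comm (+ a) (+ s))))
    from-exponent : ∃[ e ] pow (a * m) * pow s % p ≡ pow e × (+ e ≡ + s -ℤ + a mod + n) → Q∣ + s -ℤ + a
    from-exponent (e , h·r≡pow-e , e≡s-a) =
      ng-pow⇒Q∣ e (subst (NG p) h·r≡pow-e (proj₂ (ng-inverse·r (pow (a * m)) (pow-inverse a)))) e≡s-a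

  aligned⇒ni : ∀ b s → Invertible (+ b) → Crossed (+ b) → + 2 ∣ + s → Aligned (+ s) → NI p (pow b) (pow s)
  aligned⇒ni b s (b-odd , _) crossed-b s-even aligned-s = (qr , ng-b·r) , λ h h-inv → qr , ng-h·r h h-inv
    where
    qr : QR p (pow s)
    qr = even⇒qr-pow s-even
    Q∣b+s,s-b : Q∣ + b +ℤ + s × Q∣ + s -ℤ + b
    Q∣b+s,s-b = crossed-aligned⇒Q∣ {+ b} {+ s} crossed-b aligned-s
    ng-b·r : NG p (pow b * pow s % p)
    ng-b·r = subst (NG p) (pow-+ b s)
               (ng-pow (b + s) (≡mod-reflexive (ℤ.pos-+ b s)) (λ 2∣b+s → b-odd (∣m+n∣n⇒∣m 2∣b+s s-even)) (proj₁ Q∣b+s,s-b))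
    ng-h·r : ∀ h → IsInv p (pow b) h → NG p (h * pow s % p)
    ng-h·r h h-inv = from-exponent (inverse-times-pow b h-inv s)
      where
      from-exponent : ∃[ e ] h * pow s % p ≡ pow e × (+ e ≡ + s -ℤ + b mod + n) → NG p (h * pow s % p)
      from-exponent (e , h·r≡pow-e , e≡s-b) = subst (NG p) (sym h·r≡pow-e)
        (ng-pow e e≡s-b (λ 2∣s-b → b-odd (∣-resp-≡mod (≡mod 2∣s-b) s-even)) (proj₂ Q∣b+s,s-b))

  ni-transfer : ∀ a b {r} → Crossed (+ a) → Invertible (+ b) × Crossed (+ b) → NI p (pow a) r → NI p (pow b) r
  ni-transfer a b {r} crossed-a (invertible-b , crossed-b) ni = from-log (log r (proj₁ r-qr))
    where
    r-qr : QR p r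
    r-qr = proj₁ (proj₁ ni)
    from-log : ∃[ s ] pow s ≡ r → NI p (pow b) r
    from-log (s , pow-s≡r) = subst (NI p (pow b)) pow-s≡r
      (aligned⇒ni b s invertible-b crossed-b (qr-pow⇒even 2∣n (subst (QR p) (sym pow-s≡r) r-qr))
        (ni⇒aligned a s crossed-a (subst (NI p (pow a)) (sym pow-s≡r) ni)))

  ni-independent : ∀ {g₁ g₂ r} → M p g g₁ → M p g g₂ → NI p g₁ r → NI p g₂ r
  ni-independent {g₁} {g₂} {r} g₁∈M g₂∈M =
    from-logs (log g₁ (proj₁ (proj₁ g₁∈M))) (log g₂ (proj₁ (proj₁ g₂∈M)))
    where
    from-logs : ∃[ a ] pow a ≡ g₁ → ∃[ b ] pow b ≡ g₂ → NI p g₁ r → NI p g₂ r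
    from-logs (a , pow-a≡g₁) (b , pow-b≡g₂) =
      subst (λ x → NI p x r) pow-b≡g₂ ∘
      ni-transfer a b (proj₂ (m-exponent a (subst (M p g) (sym pow-a≡g₁) g₁∈M)))
                      (m-exponent b (subst (M p g) (sym pow-b≡g₂) g₂∈M)) ∘
      subst (λ x → NI p x r) (sym pow-a≡g₁)

lemma8 : (p : ℕ) .{{_ : NonZero p}} → Prime p →
    (i j₁ j₂ q₁ q₂ : ℕ) → Prime q₁ → Prime q₂ → q₁ ≢ q₂ → q₁ ≢ 2 → q₂ ≢ 2 →
    1 ≤ i → 1 ≤ j₁ → 1 ≤ j₂ → p ∸ 1 ≡ 2 ^ i * q₁ ^ j₁ * q₂ ^ j₂ →
    (g : ℕ) → Gen p g →
    (g₁ g₂ : ℕ) → M p g g₁ → M p g g₂ →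
    ∀ r → NI p g₁ r ⇔ NI p g₂ r
lemma8 zero          p-prime = ⊥-elim (¬prime[0] p-prime)
lemma8 (suc zero)    p-prime = ⊥-elim (¬prime[1] p-prime)
lemma8 (suc (suc m)) p-prime i j₁ j₂ q₁ q₂ q₁-prime q₂-prime _ q₁≢2 q₂≢2 1≤i 1≤j₁ 1≤j₂ n≡
       g g-gen g₁ g₂ g₁∈M g₂∈M r =
  mk⇔ (ni-independent g₁∈M g₂∈M) (ni-independent g₂∈M g₁∈M)
  where
  open TwoOddPrimes p-prime g-gen q₁-prime q₂-prime q₁≢2 q₂≢2 1≤i 1≤j₁ 1≤j₂ n≡
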